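{- For $j\ge0$ let $E_{j+1}$ be the digraph with vertex set $\{v_1,\dots,v_{j+1}\}$ and no arcs, and write $T_{E_{j+1},v_1}(X)=\sum_k a_{j,k}X^k$. Then for all integers $0\le k\le j$, $$a_{j,k}=\binom{j}{k}\binom{j+1}{k+1}(j-k)!.$$
   Context: For a finite simple digraph $\mathfrak G=(V,A)$ with $|V|=n$, a disposition is a bijection $f:V\to\{1,\dots,n\}$ with $f(v_1)>f(v_2)$ whenever $(v_1,v_2)\in A$, and $\sigma(\mathfrak G)$ is the number of dispositions. For $v\in V$ and $i\ge0$, $\mathfrak G_i$ is obtained from $\mathfrak G$ by adding new vertices $z_1,\dots,z_i$ and arcs $(z_0,z_1),\dots,(z_{i-1},z_i)$ with $z_0=v$. The companion polynomial $T_{\mathfrak G,v}(X)$ is the (polynomial) power series satisfying $\sum_{i\ge0}\sigma(\mathfrak G_i)X^i/i!=T_{\mathfrak G,v}(X)\exp(X)$. -}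

module Defs where

open import Data.Nat as ℕ using (ℕ; zero; suc; _+_; _∸_; _!)
open import Data.Nat.Properties using (_!≢0)

open import Data.Fin as Fin using (Fin; zero; suc; toℕ; inject₁; fromℕ; _≟_)
open import Data.Fin.Properties using (all?; any?)
open import Data.List using (List; []; _∷_; map; concatMap; filter; length; _++_)
open import Data.List.Relation.Unary.All as All using (All)
open import Data.Product using (_×_; _,_; ∃; Σ; proj₁)
open import Relation.Binary.PropositionalEquality using (_≡_)
open import Relation.Nullary using (Dec; yes; no)
open import Relation.Nullary.Decidable using (_×-dec_; _→-dec_)
open import Data.Integer using (+_)
open import Data.Rational as ℚ using (ℚ)

record Digraph : Set where
  constructor digraph
  field
    n    : ℕ
    arcs : List (Fin n × Fin n)
open Digraph public

-- A disposition: a bijection f : V → {1,…,n} (here encoded as Fin n = {0,…,n-1},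
-- an order-preserving shift) with f v₁ > f v₂ for every arc (v₁ , v₂).
Injective : ∀ {n} → (Fin n → Fin n) → Set
Injective f = ∀ x y → f x ≡ f y → x ≡ y

Surjective : ∀ {n} → (Fin n → Fin n) → Set
Surjective {n} f = ∀ (y : Fin n) → ∃ λ x → f x ≡ y

RespectsArcs : (G : Digraph) → (Fin (n G) → Fin (n G)) → Set
RespectsArcs G f = All (λ { (v₁ , v₂) → toℕ (f v₂) ℕ.< toℕ (f v₁) }) (arcs G)

IsDisposition : (G : Digraph) → (Fin (n G) → Fin (n G)) → Set
IsDisposition G f = (Injective f × Surjective f) × RespectsArcs G f

isDisposition? : (G : Digraph) → (f : Fin (n G) → Fin (n G)) → Dec (IsDisposition G f)
isDisposition? G f =
  ((all? λ x → all? λ y → (f x ≟ f y) →-dec (x ≟ y))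
    ×-dec (all? λ y → any? λ x → f x ≟ y))
  ×-dec All.all? (λ { (v₁ , v₂) → toℕ (f v₂) ℕ.<? toℕ (f v₁) }) (arcs G)

allFuns : (m k : ℕ) → List (Fin m → Fin k)
allFuns zero    k = (λ ()) ∷ []
allFuns (suc m) k =
  concatMap (λ c → map (λ g → λ { zero → c ; (suc x) → g x }) (allFuns m k))
            (Data.List.allFin k)
  where import Data.List

σ : Digraph → ℕ
σ G = length (filter (isDisposition? G) (allFuns (n G) (n G)))

-- Add a new vertex w (= fromℕ n, the old vertices being inject₁) and the arc (u , w).
addPendant : (G : Digraph) → Fin (n G) → Digraph
addPendant (digraph m as) u =
  digraph (suc m)
    (map (λ { (a , b) → (inject₁ a , inject₁ b) }) as ++ ((inject₁ u , fromℕ m) ∷ []))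

-- extend G v i = (G_i , z_i): G_i obtained from G by adding z₁,…,z_i and arcs
-- (z₀,z₁),…,(z_{i-1},z_i) with z₀ = v.
extend : (G : Digraph) → Fin (n G) → ℕ → Σ Digraph (λ H → Fin (n H))
extend G v zero    = G , v
extend G v (suc i) with extend G v i
... | H , u = addPendant H u , fromℕ (n H)

_sub_ : (G : Digraph) → Fin (n G) → ℕ → Digraph
(G sub v) i = proj₁ (extend G v i)

Σ≤ : ℕ → (ℕ → ℚ) → ℚ
Σ≤ zero    f = f zero
Σ≤ (suc i) f = Σ≤ i f ℚ.+ f (suc i)

toℚ : ℕ → ℚ
toℚ m = + m ℚ./ 1

inv! : ℕ → ℚ
inv! m = (+ 1 ℚ./ (m !)) {{m !≢0}}

-- a is the coefficient sequence of the companion power series T_{G,v}: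
-- Σ_i σ(G_i) X^i / i! = T(X) · exp(X), compared coefficientwise
-- (coefficient of X^i on the right is Σ_{k≤i} a_k / (i-k)!).
IsCompanion : (G : Digraph) → Fin (n G) → (ℕ → ℚ) → Set
IsCompanion G v a =
  ∀ i → toℚ (σ ((G sub v) i)) ℚ.* inv! i ≡ Σ≤ i (λ k → a k ℚ.* inv! (i ∸ k))

E : ℕ → Digraph
E m = digraph m []

{-# OPTIONS --safe #-}
module Submission where

-- Let Gᵢ be E_{j+1} with the path v₁ = z₀ → z₁ → … → zᵢ attached, and count the dispositions f
-- of Gᵢ with f(zᵢ) ≥ t (values taken in {0, …, n-1}). Deleting zᵢ, whose value e lies below
-- f(zᵢ₋₁), and closing the gap at e is a bijection onto the dispositions of Gᵢ₋₁ with f(zᵢ₋₁) ≥ e;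
-- for i = 0 what remains is one of the j! bijections on the other vertices. Summing over e with
-- the hockey-stick identity, there are j!·C(j+1+i-t, i+1) of them, so σ(Gᵢ) = j!·C(j+1+i, i+1).
-- By Vandermonde's identity this is Σₖ C(i,k)·k!·aₖ with aₖ = C(j,k)·C(j+1,k+1)·(j-k)!, i.e. the
-- coefficient of Xⁱ in T(X)·exp(X) times i!; that triangular system determines T, so T = Σ aₖ Xᵏ.

open import Defs

open import Data.Bool using (true; false; if_then_else_)
open import Data.Empty using (⊥-elim)
open import Data.Fin as Fin using (Fin; zero; suc; toℕ; inject₁; fromℕ; punchIn; punchOut; _≟_)
open import Data.Fin.Properties as Fin using (all?; punchIn-injective; punchInᵢ≢i; punchIn-punchOut)
import Data.Integer as ℤ
import Data.Integer.Properties as ℤ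
open import Data.List using (List; []; _∷_; _++_; map; filter; length; concatMap; tabulate; allFin)
open import Data.List.Properties using (filter-≐; filter-++; filter-none; length-++)
open import Data.List.Relation.Unary.All as All using (All)
import Data.List.Relation.Unary.All.Properties as All
open import Data.Nat as ℕ using (ℕ; zero; suc; _+_; _*_; _∸_; _!; _≤_; _<_; _≤ᵇ_; z≤n; s≤s)
open import Data.Nat.Combinatorics
  using (_C_; nCk+nC[k+1]≡[n+1]C[k+1]; nCk≡n!/k![n-k]!; k![n∸k]!∣n!; k>n⇒nCk≡0)
open import Data.Nat.DivMod using (m/n*n≡m)
import Data.Nat.Properties as ℕ
open import Data.Nat.Solver using (module +-*-Solver)
open import Data.Product as Product using (_×_; _,_; proj₁; proj₂; ∃)
open import Data.Rational as ℚ using (ℚ; toℚᵘ)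
import Data.Rational.Properties as ℚ
open import Data.Rational.Unnormalised as ℚᵘ using (mkℚᵘ; *≡*) renaming (_≃_ to _≃ᵘ_)
import Data.Rational.Unnormalised.Properties as ℚᵘ
open import Data.Sum using (_⊎_; inj₁; inj₂)
open import Data.Vec.Functional using (insertAt)
open import Data.Vec.Functional.Properties using (insertAt-lookup; insertAt-punchIn)
open import Function using (_∘_; id)
open import Relation.Binary.Definitions using (_Respects_)
open import Relation.Binary.PropositionalEquality
open import Relation.Nullary using (Dec; yes; no; does; ¬_)
open import Relation.Nullary.Decidable using (_×-dec_; ¬?; _→-dec_)
open import Relation.Unary using (Pred; Decidable; _≐_)

open import Algebra.Properties.CommutativeSemigroup ℕ.+-commutativeSemigroup
  using () renaming (x∙yz≈y∙xz to x+[y+z]≡y+[x+z])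
open import Algebra.Properties.CommutativeSemigroup ℕ.*-commutativeSemigroup
  using () renaming (x∙yz≈y∙xz to x*[y*z]≡y*[x*z])
open import Algebra.Properties.Group ℚ.+-0-group using () renaming (∙-cancelˡ to +-cancelˡ)
open import Algebra.Properties.Semiring.Sum ℕ.+-*-semiring
  using ( sum-syntax; sum-cong-≗; ∑-comm; ∑-distrib-+; *-distribˡ-sum; sum-remove; sum-init-last
        ; sum-replicate-zero)

-- Binomial sums

∑-const : ∀ l x → ∑[ i < l ] x ≡ l * x
∑-const zero    x = refl
∑-const (suc l) x = cong (x +_) (∑-const l x)

≤ᵇ-suc : ∀ t e → (suc t ≤ᵇ suc e) ≡ (t ≤ᵇ e)
≤ᵇ-suc zero    e = refl
≤ᵇ-suc (suc t) e = refl

∑-hockeyStick : ∀ M t r c →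
  ∑[ e < M ] (if t ≤ᵇ toℕ e then c * ((M ∸ suc (toℕ e)) C r) else 0) ≡ c * ((M ∸ t) C suc r)
∑-hockeyStick zero t r c = sym (trans (cong (λ x → c * (x C suc r)) (ℕ.0∸n≡0 t)) (ℕ.*-zeroʳ c))
∑-hockeyStick (suc M) zero r c = begin
  c * (M C r) + ∑[ e < M ] (c * ((M ∸ suc (toℕ e)) C r))
                                 ≡⟨ cong (c * (M C r) +_) (∑-hockeyStick M zero r c) ⟩
  c * (M C r) + c * (M C suc r) ≡⟨ ℕ.*-distribˡ-+ c (M C r) (M C suc r) ⟨
  c * (M C r + M C suc r)        ≡⟨ cong (c *_) (nCk+nC[k+1]≡[n+1]C[k+1] M r) ⟩
  c * (suc M C suc r)            ∎
  where open ≡-Reasoning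
∑-hockeyStick (suc M) (suc t) r c =
  trans (sum-cong-≗ {M} λ e →
           cong (λ b → if b then c * ((M ∸ suc (toℕ e)) C r) else 0) (≤ᵇ-suc t (toℕ e)))
        (∑-hockeyStick M t r c)

-- The sum may run past k = i, where i C k = 0; the induction step needs this slack.
∑-vandermonde : ∀ {L} i m s → i < L →
  ∑[ k < L ] ((i C toℕ k) * (m C (s + toℕ k))) ≡ (m + i) C (s + i)
∑-vandermonde {suc L} zero m s _ = begin
  1 * (m C (s + 0)) + ∑[ k < L ] 0 ≡⟨ cong₂ _+_ (ℕ.*-identityˡ _) (sum-replicate-zero L) ⟩
  m C (s + 0) + 0                  ≡⟨ ℕ.+-identityʳ _ ⟩
  m C (s + 0)                      ≡⟨ cong (_C (s + 0)) (ℕ.+-identityʳ m) ⟨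
  (m + 0) C (s + 0)                ∎
  where open ≡-Reasoning
∑-vandermonde {suc L} (suc i) m s (s≤s i<L) = begin
  (i C 0) * g 0 + ∑[ k < L ] ((suc i C suc (toℕ k)) * g (suc (toℕ k)))
    ≡⟨ cong ((i C 0) * g 0 +_) (sum-cong-≗ {L} λ k →
         trans (cong (_* g (suc (toℕ k))) (sym (nCk+nC[k+1]≡[n+1]C[k+1] i (toℕ k))))
               (ℕ.*-distribʳ-+ (g (suc (toℕ k))) (i C toℕ k) (i C suc (toℕ k)))) ⟩
  (i C 0) * g 0 + ∑[ k < L ] ((i C toℕ k) * g (suc (toℕ k)) + (i C suc (toℕ k)) * g (suc (toℕ k)))
    ≡⟨ cong ((i C 0) * g 0 +_) (∑-distrib-+ {L} (λ k → (i C toℕ k) * g (suc (toℕ k)))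
                                                (λ k → (i C suc (toℕ k)) * g (suc (toℕ k)))) ⟩
  (i C 0) * g 0 + (A + B)
    ≡⟨ x+[y+z]≡y+[x+z] ((i C 0) * g 0) A B ⟩
  A + ((i C 0) * g 0 + B)
    ≡⟨ cong₂ _+_ A≡ (∑-vandermonde {suc L} i m s (ℕ.m<n⇒m<1+n i<L)) ⟩
  (m + i) C (suc s + i) + (m + i) C (s + i)
    ≡⟨ ℕ.+-comm ((m + i) C (suc s + i)) _ ⟩
  (m + i) C (s + i) + (m + i) C suc (s + i)
    ≡⟨ nCk+nC[k+1]≡[n+1]C[k+1] (m + i) (s + i) ⟩
  suc (m + i) C suc (s + i)
    ≡⟨ cong₂ _C_ (ℕ.+-suc m i) (ℕ.+-suc s i) ⟨
  (m + suc i) C (s + suc i) ∎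
  where
  open ≡-Reasoning
  g : ℕ → ℕ
  g k = m C (s + k)
  A = ∑[ k < L ] ((i C toℕ k) * g (suc (toℕ k)))
  B = ∑[ k < L ] ((i C suc (toℕ k)) * g (suc (toℕ k)))
  A≡ : A ≡ (m + i) C (suc s + i)
  A≡ = trans (sum-cong-≗ {L} λ k → cong (λ x → (i C toℕ k) * (m C x)) (ℕ.+-suc s (toℕ k)))
             (∑-vandermonde {L} i m (suc s) i<L)

nCk*[k!*[n∸k]!]≡n! : ∀ {l k} → k ≤ l → (l C k) * (k ! * (l ∸ k) !) ≡ l !
nCk*[k!*[n∸k]!]≡n! {l} {k} k≤l =
  trans (cong (_* (k ! * (l ∸ k) !)) (nCk≡n!/k![n-k]! k≤l)) (m/n*n≡m (k![n∸k]!∣n! k≤l))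
  where instance _ = k ℕ.!* (l ∸ k) !≢0

coefficient : ℕ → ℕ → ℕ
coefficient j k = (j C k) * (suc j C suc k) * (j ∸ k) !

k!*coefficient≡j!*[1+j]C[1+k] : ∀ j k → k ! * coefficient j k ≡ j ! * (suc j C suc k)
k!*coefficient≡j!*[1+j]C[1+k] j k with k ℕ.≤? j
... | yes k≤j = begin
  k ! * ((j C k) * (suc j C suc k) * (j ∸ k) !)
    ≡⟨ rearrange (k !) (j C k) (suc j C suc k) ((j ∸ k) !) ⟩
  (j C k) * (k ! * (j ∸ k) !) * (suc j C suc k)
    ≡⟨ cong (_* (suc j C suc k)) (nCk*[k!*[n∸k]!]≡n! k≤j) ⟩
  j ! * (suc j C suc k) ∎
  where
  open ≡-Reasoning
  rearrange : ∀ a b c d → a * (b * c * d) ≡ b * (a * d) * c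
  rearrange = solve 4 (λ a b c d → a :* (b :* c :* d) := b :* (a :* d) :* c) refl
    where open +-*-Solver
... | no k≰j rewrite k>n⇒nCk≡0 (ℕ.≰⇒> k≰j) | k>n⇒nCk≡0 (s≤s (ℕ.≰⇒> k≰j)) =
  trans (ℕ.*-zeroʳ (k !)) (sym (ℕ.*-zeroʳ (j !)))

-- Functions between finite sets

insertAt-cong : ∀ {a m} {A : Set a} {xs ys : Fin m → A} (i : Fin (suc m)) (v : A) →
  xs ≗ ys → insertAt xs i v ≗ insertAt ys i v
insertAt-cong zero    v xs≗ys zero    = refl
insertAt-cong zero    v xs≗ys (suc j) = xs≗ys j
insertAt-cong {m = suc m} (suc i) v xs≗ys zero    = xs≗ys zero
insertAt-cong {m = suc m} (suc i) v xs≗ys (suc j) = insertAt-cong i v (xs≗ys ∘ suc) j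

insertAt-fromℕ-inject₁ : ∀ {a m} {A : Set a} (xs : Fin m → A) (v : A) (j : Fin m) →
  insertAt xs (fromℕ m) v (inject₁ j) ≡ xs j
insertAt-fromℕ-inject₁ {m = suc m} xs v zero    = refl
insertAt-fromℕ-inject₁ {m = suc m} xs v (suc j) = insertAt-fromℕ-inject₁ (xs ∘ suc) v j

punchIn-view : ∀ {m} (i x : Fin (suc m)) → x ≡ i ⊎ ∃ λ y → x ≡ punchIn i y
punchIn-view i x with i ≟ x
... | yes refl = inj₁ refl
... | no  i≢x  = inj₂ (punchOut i≢x , sym (punchIn-punchOut i≢x))

punchIn-mono-< : ∀ {m} (c : Fin (suc m)) {a b : Fin m} →
  toℕ a < toℕ b → toℕ (punchIn c a) < toℕ (punchIn c b)
punchIn-mono-< c {a} {b} a<b = ℕ.≰⇒> (ℕ.<⇒≱ a<b ∘ Fin.punchIn-cancel-≤ c b a)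

punchIn-cancel-< : ∀ {m} (c : Fin (suc m)) {a b : Fin m} →
  toℕ (punchIn c a) < toℕ (punchIn c b) → toℕ a < toℕ b
punchIn-cancel-< c {a} {b} ca<cb = ℕ.≰⇒> (ℕ.<⇒≱ ca<cb ∘ Fin.punchIn-mono-≤ c b a)

<punchIn⇒≤ : ∀ {m} (c : Fin (suc m)) (x : Fin m) → toℕ c < toℕ (punchIn c x) → toℕ c ≤ toℕ x
<punchIn⇒≤ zero    x       _         = z≤n
<punchIn⇒≤ (suc c) (suc x) (s≤s c<x) = s≤s (<punchIn⇒≤ c x c<x)

≤⇒<punchIn : ∀ {m} (c : Fin (suc m)) (x : Fin m) → toℕ c ≤ toℕ x → toℕ c < toℕ (punchIn c x)
≤⇒<punchIn zero    x       _         = s≤s z≤n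
≤⇒<punchIn (suc c) (suc x) (s≤s c≤x) = s≤s (≤⇒<punchIn c x c≤x)

-- Counting functions

module _ {a p} {A : Set a} {P : Pred A p} (P? : Decidable P) where

  length-filter-++ : ∀ xs ys →
    length (filter P? (xs ++ ys)) ≡ length (filter P? xs) + length (filter P? ys)
  length-filter-++ xs ys = trans (cong length (filter-++ P? xs ys)) (length-++ (filter P? xs))

  length-filter-map : ∀ {b} {B : Set b} (h : B → A) xs →
    length (filter P? (map h xs)) ≡ length (filter (P? ∘ h) xs)
  length-filter-map h [] = refl
  length-filter-map h (x ∷ xs) with does (P? (h x))
  ... | true  = cong suc (length-filter-map h xs)
  ... | false = length-filter-map h xs

  length-filter-concatMap : ∀ {b m} {B : Set b} (F : B → List A) (g : Fin m → B) →
    length (filter P? (concatMap F (tabulate g))) ≡ ∑[ c < m ] length (filter P? (F (g c)))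
  length-filter-concatMap {m = zero}  F g = refl
  length-filter-concatMap {m = suc m} F g =
    trans (length-filter-++ (F (g zero)) _) (cong (_ +_) (length-filter-concatMap F (g ∘ suc)))

length-filter-[x] : ∀ {a b p q} {A : Set a} {B : Set b} {P : Pred A p} {Q : Pred B q}
  (P? : Decidable P) (Q? : Decidable Q) {x y} → (P x → Q y) → (Q y → P x) →
  length (filter P? (x ∷ [])) ≡ length (filter Q? (y ∷ []))
length-filter-[x] P? Q? {x} {y} Px⇒Qy Qy⇒Px with P? x | Q? y
... | yes _  | yes _  = refl
... | yes Px | no ¬Qy = ⊥-elim (¬Qy (Px⇒Qy Px))
... | no ¬Px | yes Qy = ⊥-elim (¬Px (Qy⇒Px Qy))
... | no _   | no _   = refl

count : ∀ {m k p} {P : Pred (Fin m → Fin k) p} → Decidable P → ℕ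
count {m} {k} P? = length (filter P? (allFuns m k))

module _ {m k p q} {P : Pred (Fin m → Fin k) p} {Q : Pred (Fin m → Fin k) q} where

  count-≐ : (P? : Decidable P) (Q? : Decidable Q) → P ≐ Q → count P? ≡ count Q?
  count-≐ P? Q? P≐Q = cong length (filter-≐ P? Q? P≐Q (allFuns m k))

count-none : ∀ {m k p} {P : Pred (Fin m → Fin k) p} (P? : Decidable P) → (∀ f → ¬ P f) →
  count P? ≡ 0
count-none {m} {k} P? ¬P = cong length (filter-none P? {allFuns m k} (All.tabulate λ {f} _ → ¬P f))

module _ {m k p} {P : Pred (Fin m → Fin k) p} (P? : Decidable P) where

  count-×-dec : ∀ {b} {B : Set b} (B? : Dec B) →
    count (λ f → P? f ×-dec B?) ≡ (if does B? then count P? else 0)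
  count-×-dec (yes b) = count-≐ (λ f → P? f ×-dec yes b) P? (proj₁ , (_, b))
  count-×-dec (no ¬b) = count-none (λ f → P? f ×-dec no ¬b) (λ _ → ¬b ∘ proj₂)

-- allFuns extends a function by its value at zero with an anonymous λ that agrees with insertAt
-- only pointwise; hence the abstraction over that λ (h) and the hypothesis P Respects _≗_.
count-insertAt-zero : ∀ {m k p} {P : Pred (Fin (suc m) → Fin k) p} (P? : Decidable P) →
  P Respects _≗_ → count P? ≡ ∑[ c < k ] count (λ g → P? (insertAt g zero c))
count-insertAt-zero {m} {k} P? resp = allFuns-suc _ (λ { c g zero → refl ; c g (suc x) → refl })
  where
  allFuns-suc : (h : Fin k → (Fin m → Fin k) → (Fin (suc m) → Fin k)) →
    (∀ c g → h c g ≗ insertAt g zero c) →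
    length (filter P? (concatMap (λ c → map (h c) (allFuns m k)) (allFin k)))
      ≡ ∑[ c < k ] count (λ g → P? (insertAt g zero c))
  allFuns-suc h h≗insertAt =
    trans (length-filter-concatMap P? (λ c → map (h c) (allFuns m k)) id) (sum-cong-≗ λ c →
    trans (length-filter-map P? (h c) (allFuns m k))
          (count-≐ (P? ∘ h c) (λ g → P? (insertAt g zero c))
            (resp (h≗insertAt c _) , resp (sym ∘ h≗insertAt c _))))

count-insertAt : ∀ {m k p} {P : Pred (Fin (suc m) → Fin k) p} (P? : Decidable P) →
  P Respects _≗_ → (i : Fin (suc m)) → count P? ≡ ∑[ v < k ] count (λ g → P? (insertAt g i v))
count-insertAt P? resp zero = count-insertAt-zero P? resp
count-insertAt {suc m} {k} P? resp (suc i) = begin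
  count P?
    ≡⟨ count-insertAt-zero P? resp ⟩
  ∑[ c < k ] count (λ g → P? (insertAt g zero c))
    ≡⟨ sum-cong-≗ (λ c →
         count-insertAt (λ g → P? (insertAt g zero c)) (resp ∘ insertAt-cong zero c) i) ⟩
  ∑[ c < k ] ∑[ v < k ] count (λ g → P? (insertAt (insertAt g i v) zero c))
    ≡⟨ ∑-comm (λ c v → count (λ g → P? (insertAt (insertAt g i v) zero c))) ⟩
  ∑[ v < k ] ∑[ c < k ] count (λ g → P? (insertAt (insertAt g i v) zero c))
    ≡⟨ sum-cong-≗ (λ v → sym (trans
         (count-insertAt-zero (λ h → P? (insertAt h (suc i) v)) (resp ∘ insertAt-cong (suc i) v))
         (sum-cong-≗ λ c → count-≐ (λ g → P? (insertAt (insertAt g zero c) (suc i) v))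
                                   (λ g → P? (insertAt (insertAt g i v) zero c))
                                   (resp reorder , resp (sym ∘ reorder))))) ⟩
  ∑[ v < k ] count (λ h → P? (insertAt h (suc i) v)) ∎
  where
  open ≡-Reasoning
  reorder : ∀ {g : Fin m → Fin k} {c v} →
    insertAt (insertAt g zero c) (suc i) v ≗ insertAt (insertAt g i v) zero c
  reorder zero    = refl
  reorder (suc j) = refl

Avoids : ∀ {m k} → Fin k → (Fin m → Fin k) → Set
Avoids c g = ∀ x → g x ≢ c

avoids? : ∀ {m k} (c : Fin k) → Decidable (Avoids {m} c)
avoids? c g = all? λ x → ¬? (g x ≟ c)

avoids-resp : ∀ {m k} (c : Fin k) → Avoids {m} c Respects _≗_
avoids-resp c f≗g avoids x gx≡c = avoids x (trans (f≗g x) gx≡c)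

count-avoids : ∀ {m k p} {P : Pred (Fin m → Fin (suc k)) p} (P? : Decidable P) →
  P Respects _≗_ → (c : Fin (suc k)) →
  count (λ g → avoids? c g ×-dec P? g) ≡ count (λ h → P? (punchIn c ∘ h))
count-avoids {zero} P? resp c =
  length-filter-[x] (λ g → avoids? c g ×-dec P? g) (λ h → P? (punchIn c ∘ h))
    (λ (_ , Pg) → resp (λ ()) Pg) (λ Ph → (λ ()) , resp (λ ()) Ph)
count-avoids {suc m} {k} P? resp c = begin
  count (λ g → avoids? c g ×-dec P? g)
    ≡⟨ count-insertAt-zero (λ g → avoids? c g ×-dec P? g)
         (λ f≗g (av , Pf) → avoids-resp c f≗g av , resp f≗g Pf) ⟩
  ∑[ d < suc k ] T d
    ≡⟨ sum-remove {i = c} T ⟩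
  T c + ∑[ d < k ] T (punchIn c d)
    ≡⟨ cong₂ _+_ (count-none (λ g → avoids? c (insertAt g zero c) ×-dec P? (insertAt g zero c))
                             (λ g (av , _) → av zero refl))
                 (sum-cong-≗ T∘punchIn) ⟩
  0 + ∑[ d < k ] count (λ h → P? (insertAt (punchIn c ∘ h) zero (punchIn c d)))
    ≡⟨ sum-cong-≗ (λ d → count-≐ (λ h → P? (insertAt (punchIn c ∘ h) zero (punchIn c d)))
                                 (λ h → P? (punchIn c ∘ insertAt h zero d))
                                 (resp punchIn-insertAt , resp (sym ∘ punchIn-insertAt))) ⟩
  ∑[ d < k ] count (λ h → P? (punchIn c ∘ insertAt h zero d))
    ≡⟨ count-insertAt-zero (λ h → P? (punchIn c ∘ h)) (λ f≗g → resp (cong (punchIn c) ∘ f≗g)) ⟨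
  count (λ h → P? (punchIn c ∘ h)) ∎
  where
  open ≡-Reasoning
  T : Fin (suc k) → ℕ
  T d = count (λ g → avoids? c (insertAt g zero d) ×-dec P? (insertAt g zero d))

  punchIn-insertAt : ∀ {h : Fin m → Fin k} {d} →
    insertAt (punchIn c ∘ h) zero (punchIn c d) ≗ punchIn c ∘ insertAt h zero d
  punchIn-insertAt zero    = refl
  punchIn-insertAt (suc x) = refl

  T∘punchIn : ∀ d →
    T (punchIn c d) ≡ count (λ h → P? (insertAt (punchIn c ∘ h) zero (punchIn c d)))
  T∘punchIn d = trans
    (count-≐ (λ g → avoids? c (insertAt g zero e) ×-dec P? (insertAt g zero e))
             (λ g → avoids? c g ×-dec P? (insertAt g zero e))
             ((λ (av , Pg) → av ∘ suc , Pg) ,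
              (λ (av , Pg) → (λ { zero → punchInᵢ≢i c d ; (suc x) → av x }) , Pg)))
    (count-avoids (λ g → P? (insertAt g zero e)) (resp ∘ insertAt-cong zero e) c)
    where e = punchIn c d

-- Injections

-- Injective of Defs, for functions between different finite sets.
IsInjective : ∀ {m k} → (Fin m → Fin k) → Set
IsInjective f = ∀ x y → f x ≡ f y → x ≡ y

isInjective? : ∀ {m k} → Decidable (IsInjective {m} {k})
isInjective? f = all? λ x → all? λ y → (f x ≟ f y) →-dec (x ≟ y)

isInjective-resp : ∀ {m k} → IsInjective {m} {k} Respects _≗_
isInjective-resp f≗g inj x y gx≡gy = inj x y (trans (f≗g x) (trans gx≡gy (sym (f≗g y))))

isInjective-punchIn∘ : ∀ {m k} (c : Fin (suc k)) →
  (λ h → IsInjective (punchIn c ∘ h)) ≐ IsInjective {m} {k}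
isInjective-punchIn∘ c =
  (λ inj x y hx≡hy → inj x y (cong (punchIn c) hx≡hy)) ,
  (λ inj x y chx≡chy → inj x y (punchIn-injective c _ _ chx≡chy))

isInjective-insertAt : ∀ {m k} (i : Fin (suc m)) (c : Fin k) →
  (λ g → IsInjective (insertAt g i c)) ≐ (λ g → Avoids c g × IsInjective g)
isInjective-insertAt i c = ⇒ , ⇐
  where
  ⇒ : ∀ {g} → IsInjective (insertAt g i c) → Avoids c g × IsInjective g
  ⇒ {g} inj =
    (λ x gx≡c → punchInᵢ≢i i x (inj _ _ (trans (insertAt-punchIn g i c x)
                                          (trans gx≡c (sym (insertAt-lookup g i c)))))) ,
    (λ x y gx≡gy → punchIn-injective i x y (inj _ _ (trans (insertAt-punchIn g i c x)
                                          (trans gx≡gy (sym (insertAt-punchIn g i c y))))))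

  ⇐ : ∀ {g} → Avoids c g × IsInjective g → IsInjective (insertAt g i c)
  ⇐ {g} (avoids , inj) x y eq with punchIn-view i x | punchIn-view i y
  ... | inj₁ refl         | inj₁ refl         = refl
  ... | inj₁ refl         | inj₂ (y′ , refl) =
    ⊥-elim (avoids y′ (trans (sym (insertAt-punchIn g i c y′)) (trans (sym eq) (insertAt-lookup g i c))))
  ... | inj₂ (x′ , refl) | inj₁ refl         =
    ⊥-elim (avoids x′ (trans (sym (insertAt-punchIn g i c x′)) (trans eq (insertAt-lookup g i c))))
  ... | inj₂ (x′ , refl) | inj₂ (y′ , refl) =
    cong (punchIn i) (inj x′ y′ (trans (sym (insertAt-punchIn g i c x′))
                                       (trans eq (insertAt-punchIn g i c y′))))

count-injective : ∀ m → count (isInjective? {m} {m}) ≡ m !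

count-injective-insertAt : ∀ m (i c : Fin (suc m)) →
  count (λ g → isInjective? (insertAt g i c)) ≡ m !
count-injective-insertAt m i c = begin
  count (λ g → isInjective? (insertAt g i c))
    ≡⟨ count-≐ (λ g → isInjective? (insertAt g i c)) (λ g → avoids? c g ×-dec isInjective? g)
               (isInjective-insertAt i c) ⟩
  count (λ (g : Fin m → Fin (suc m)) → avoids? c g ×-dec isInjective? g)
    ≡⟨ count-avoids {m} isInjective? isInjective-resp c ⟩
  count (λ (h : Fin m → Fin m) → isInjective? (punchIn c ∘ h))
    ≡⟨ count-≐ (λ h → isInjective? (punchIn c ∘ h)) (isInjective? {m} {m}) (isInjective-punchIn∘ c) ⟩
  count (isInjective? {m} {m})
    ≡⟨ count-injective m ⟩
  m ! ∎
  where open ≡-Reasoning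

count-injective zero    = refl
count-injective (suc m) = begin
  count (isInjective? {suc m} {suc m})
    ≡⟨ count-insertAt (isInjective? {suc m} {suc m}) isInjective-resp zero ⟩
  ∑[ c < suc m ] count (λ (g : Fin m → Fin (suc m)) → isInjective? (insertAt g zero c))
    ≡⟨ sum-cong-≗ (count-injective-insertAt m zero) ⟩
  ∑[ c < suc m ] (m !)
    ≡⟨ ∑-const (suc m) (m !) ⟩
  suc m ! ∎
  where open ≡-Reasoning

-- Dispositions

-- RespectsArcs of Defs, for functions into any Fin k.
Decreasing : ∀ {m k} → List (Fin m × Fin m) → (Fin m → Fin k) → Set
Decreasing es f = All (λ (a , b) → toℕ (f b) < toℕ (f a)) es

decreasing? : ∀ {m k} (es : List (Fin m × Fin m)) → Decidable (Decreasing {m} {k} es)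
decreasing? es f = All.all? (λ (a , b) → toℕ (f b) ℕ.<? toℕ (f a)) es

decreasing-resp : ∀ {m k} (es : List (Fin m × Fin m)) → Decreasing {m} {k} es Respects _≗_
decreasing-resp es f≗g = All.map λ {(a , b)} → subst₂ _<_ (cong toℕ (f≗g b)) (cong toℕ (f≗g a))

injective⇒surjective : ∀ {m} (f : Fin m → Fin m) → IsInjective f → Surjective f
injective⇒surjective {suc m} f inj y with Fin.any? (λ x → f x ≟ y)
... | yes hit = hit
... | no miss = ⊥-elim (ℕ.<-irrefl refl (Fin.injective⇒≤ squeeze-injective))
  where
  squeeze : Fin (suc m) → Fin m
  squeeze x = punchOut {i = y} {j = f x} (λ y≡fx → miss (x , sym y≡fx))

  squeeze-injective : ∀ {a b} → squeeze a ≡ squeeze b → a ≡ b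
  squeeze-injective {a} {b} = inj a b ∘ Fin.punchOut-injective {i = y} _ _

isDisposition≐ : (G : Digraph) → IsDisposition G ≐ (λ f → IsInjective f × Decreasing (arcs G) f)
isDisposition≐ G =
  (λ ((inj , _) , dec) → inj , dec) ,
  (λ (inj , dec) → (inj , injective⇒surjective _ inj) , dec)

isDisposition-resp : (G : Digraph) → IsDisposition G Respects _≗_
isDisposition-resp G f≗g disp with (inj , dec) ← proj₁ (isDisposition≐ G) disp =
  proj₂ (isDisposition≐ G) (isInjective-resp f≗g inj , decreasing-resp (arcs G) f≗g dec)

decreasing-addPendant : (G : Digraph) (u : Fin (n G)) (e : Fin (suc (n G))) →
  (λ g → Decreasing (arcs (addPendant G u)) (insertAt g (fromℕ (n G)) e))
    ≐ (λ g → Decreasing (arcs G) g × toℕ e < toℕ (g u))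
decreasing-addPendant G u e = ⇒ , ⇐
  where
  m = n G
  module _ {g : Fin m → Fin (suc m)} where
    f = insertAt g (fromℕ m) e

    f∘inject₁ : ∀ x → f (inject₁ x) ≡ g x
    f∘inject₁ = insertAt-fromℕ-inject₁ g e

    f-last : f (fromℕ m) ≡ e
    f-last = insertAt-lookup g (fromℕ m) e

    ⇒ : Decreasing (arcs (addPendant G u)) f → Decreasing (arcs G) g × toℕ e < toℕ (g u)
    ⇒ dec with last All.∷ All.[] ← All.++⁻ʳ (map _ (arcs G)) dec =
      All.map (λ {(a , b)} → subst₂ _<_ (cong toℕ (f∘inject₁ b)) (cong toℕ (f∘inject₁ a)))
              (All.map⁻ (All.++⁻ˡ (map _ (arcs G)) dec)) ,
      subst₂ _<_ (cong toℕ f-last) (cong toℕ (f∘inject₁ u)) last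

    ⇐ : Decreasing (arcs G) g × toℕ e < toℕ (g u) → Decreasing (arcs (addPendant G u)) f
    ⇐ (dec , e<gu) =
      All.++⁺ (All.map⁺ (All.map (λ {(a , b)} → subst₂ _<_ (cong toℕ (sym (f∘inject₁ b)))
                                                          (cong toℕ (sym (f∘inject₁ a)))) dec))
              (subst₂ _<_ (cong toℕ (sym f-last)) (cong toℕ (sym (f∘inject₁ u))) e<gu All.∷ All.[])

decreasing-punchIn∘ : ∀ {m k} (es : List (Fin m × Fin m)) (c : Fin (suc k)) →
  (λ h → Decreasing es (punchIn c ∘ h)) ≐ Decreasing es
decreasing-punchIn∘ es c = All.map (punchIn-cancel-< c) , All.map (punchIn-mono-< c)

isDisposition-addPendant : (G : Digraph) (u : Fin (n G)) (e : Fin (suc (n G))) →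
  (λ g → IsDisposition (addPendant G u) (insertAt g (fromℕ (n G)) e))
    ≐ (λ g → Avoids e g × (IsInjective g × Decreasing (arcs G) g × toℕ e < toℕ (g u)))
isDisposition-addPendant G u e =
  (λ disp → let (inj , dec) = proj₁ (isDisposition≐ (addPendant G u)) disp
                (avoids , inj′) = proj₁ (isInjective-insertAt (fromℕ (n G)) e) inj
                (dec′ , e<gu) = proj₁ (decreasing-addPendant G u e) dec
            in avoids , inj′ , dec′ , e<gu) ,
  (λ (avoids , inj , dec , e<gu) →
     proj₂ (isDisposition≐ (addPendant G u))
       (proj₂ (isInjective-insertAt (fromℕ (n G)) e) (avoids , inj) ,
        proj₂ (decreasing-addPendant G u e) (dec , e<gu)))

-- The bijection deletes the value e of the new vertex and closes the gap (punchIn e).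
count-addPendant : (G : Digraph) (u : Fin (n G)) (e : Fin (suc (n G))) →
  count (λ g → isDisposition? (addPendant G u) (insertAt g (fromℕ (n G)) e))
    ≡ count (λ h → isDisposition? G h ×-dec toℕ e ℕ.≤? toℕ (h u))
count-addPendant G u e = begin
  count (λ g → isDisposition? (addPendant G u) (insertAt g (fromℕ (n G)) e))
    ≡⟨ count-≐ (λ g → isDisposition? (addPendant G u) (insertAt g (fromℕ (n G)) e))
               (λ g → avoids? e g ×-dec Q? g) (isDisposition-addPendant G u e) ⟩
  count (λ g → avoids? e g ×-dec Q? g)
    ≡⟨ count-avoids Q? Q-resp e ⟩
  count (λ h → Q? (punchIn e ∘ h))
    ≡⟨ count-≐ (λ h → Q? (punchIn e ∘ h))
               (λ h → isDisposition? G h ×-dec toℕ e ℕ.≤? toℕ (h u)) (Q∘punchIn⇒ , Q∘punchIn⇐) ⟩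
  count (λ h → isDisposition? G h ×-dec toℕ e ℕ.≤? toℕ (h u)) ∎
  where
  open ≡-Reasoning
  m = n G

  Q : Pred (Fin m → Fin (suc m)) _
  Q g = IsInjective g × Decreasing (arcs G) g × toℕ e < toℕ (g u)

  Q? : Decidable Q
  Q? g = isInjective? g ×-dec decreasing? (arcs G) g ×-dec toℕ e ℕ.<? toℕ (g u)

  Q-resp : Q Respects _≗_
  Q-resp f≗g (inj , dec , e<fu) =
    isInjective-resp f≗g inj , decreasing-resp (arcs G) f≗g dec ,
    subst (toℕ e <_) (cong toℕ (f≗g u)) e<fu

  Q∘punchIn⇒ : ∀ {h} → Q (punchIn e ∘ h) → IsDisposition G h × toℕ e ≤ toℕ (h u)
  Q∘punchIn⇒ {h} (inj , dec , e<eh) =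
    proj₂ (isDisposition≐ G)
      (proj₁ (isInjective-punchIn∘ e) inj , proj₁ (decreasing-punchIn∘ (arcs G) e) dec) ,
    <punchIn⇒≤ e (h u) e<eh

  Q∘punchIn⇐ : ∀ {h} → IsDisposition G h × toℕ e ≤ toℕ (h u) → Q (punchIn e ∘ h)
  Q∘punchIn⇐ {h} (disp , e≤h) with (inj , dec) ← proj₁ (isDisposition≐ G) disp =
    proj₂ (isInjective-punchIn∘ e) inj , proj₂ (decreasing-punchIn∘ (arcs G) e) dec ,
    ≤⇒<punchIn e (h u) e≤h

-- Dispositions bounded below at a vertex

IsDisposition≥ : (G : Digraph) → Fin (n G) → ℕ → Pred (Fin (n G) → Fin (n G)) _
IsDisposition≥ G v t f = IsDisposition G f × t ≤ toℕ (f v)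

isDisposition≥? : (G : Digraph) (v : Fin (n G)) (t : ℕ) → Decidable (IsDisposition≥ G v t)
isDisposition≥? G v t f = isDisposition? G f ×-dec t ℕ.≤? toℕ (f v)

isDisposition≥-resp : (G : Digraph) (v : Fin (n G)) (t : ℕ) → IsDisposition≥ G v t Respects _≗_
isDisposition≥-resp G v t f≗g (disp , t≤fv) =
  isDisposition-resp G f≗g disp , subst (t ≤_) (cong toℕ (f≗g v)) t≤fv

σ≥ : (G : Digraph) → Fin (n G) → ℕ → ℕ
σ≥ G v t = count (isDisposition≥? G v t)

σ≥-addPendant : (G : Digraph) (u : Fin (n G)) (t : ℕ) →
  σ≥ (addPendant G u) (fromℕ (n G)) t
    ≡ ∑[ e < suc (n G) ] (if t ≤ᵇ toℕ e then σ≥ G u (toℕ e) else 0)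
σ≥-addPendant G u t = begin
  σ≥ G′ w t
    ≡⟨ count-insertAt (isDisposition≥? G′ w t) (isDisposition≥-resp G′ w t) w ⟩
  ∑[ e < suc m ] count (λ g → D? e g ×-dec t ℕ.≤? toℕ (insertAt g w e w))
    ≡⟨ sum-cong-≗ (λ e → count-≐ (λ g → D? e g ×-dec t ℕ.≤? toℕ (insertAt g w e w))
                                 (λ g → D? e g ×-dec t ℕ.≤? toℕ e)
                                 (Product.map₂ (subst (t ≤_) (value-at-w e)) ,
                                  Product.map₂ (subst (t ≤_) (sym (value-at-w e))))) ⟩
  ∑[ e < suc m ] count (λ g → D? e g ×-dec t ℕ.≤? toℕ e)
    ≡⟨ sum-cong-≗ (λ e → count-×-dec (D? e) (t ℕ.≤? toℕ e)) ⟩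
  ∑[ e < suc m ] (if t ≤ᵇ toℕ e then count (D? e) else 0)
    ≡⟨ sum-cong-≗ (λ e → cong (λ x → if t ≤ᵇ toℕ e then x else 0) (count-addPendant G u e)) ⟩
  ∑[ e < suc m ] (if t ≤ᵇ toℕ e then σ≥ G u (toℕ e) else 0) ∎
  where
  open ≡-Reasoning
  m = n G
  G′ = addPendant G u
  w = fromℕ m

  D? : (e : Fin (suc m)) → Decidable (λ g → IsDisposition G′ (insertAt g w e))
  D? e g = isDisposition? G′ (insertAt g w e)

  value-at-w : ∀ e {g} → toℕ (insertAt g w e w) ≡ toℕ e
  value-at-w e {g} = cong toℕ (insertAt-lookup g w e)

σ≥-edgeless : ∀ m t → σ≥ (E (suc m)) zero t ≡ ∑[ c < suc m ] (if t ≤ᵇ toℕ c then m ! else 0)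
σ≥-edgeless m t = begin
  σ≥ (E (suc m)) zero t
    ≡⟨ count-insertAt (isDisposition≥? (E (suc m)) zero t) (isDisposition≥-resp (E (suc m)) zero t) zero ⟩
  ∑[ c < suc m ] count (λ g → D? c g ×-dec t ℕ.≤? toℕ c)
    ≡⟨ sum-cong-≗ (λ c → count-×-dec (D? c) (t ℕ.≤? toℕ c)) ⟩
  ∑[ c < suc m ] (if t ≤ᵇ toℕ c then count (D? c) else 0)
    ≡⟨ sum-cong-≗ (λ c → cong (λ x → if t ≤ᵇ toℕ c then x else 0) (trans
         (count-≐ (D? c) (λ g → isInjective? (insertAt g zero c)) dispositions≐injections)
         (count-injective-insertAt m zero c))) ⟩
  ∑[ c < suc m ] (if t ≤ᵇ toℕ c then m ! else 0) ∎
  where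
  open ≡-Reasoning
  D? : (c : Fin (suc m)) → Decidable (λ g → IsDisposition (E (suc m)) (insertAt g zero c))
  D? c g = isDisposition? (E (suc m)) (insertAt g zero c)

  dispositions≐injections : ∀ {c} →
    (λ g → IsDisposition (E (suc m)) (insertAt g zero c)) ≐ (λ g → IsInjective (insertAt g zero c))
  dispositions≐injections =
    proj₁ ∘ proj₁ (isDisposition≐ (E (suc m))) , λ inj → proj₂ (isDisposition≐ (E (suc m))) (inj , All.[])

tip : (G : Digraph) (v : Fin (n G)) (i : ℕ) → Fin (n ((G sub v) i))
tip G v i = proj₂ (extend G v i)

n-sub : (G : Digraph) (v : Fin (n G)) (i : ℕ) → n ((G sub v) i) ≡ n G + i
n-sub G v zero    = sym (ℕ.+-identityʳ (n G))
n-sub G v (suc i) = trans (cong suc (n-sub G v i)) (sym (ℕ.+-suc (n G) i))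

module _ (j : ℕ) where

  Gᵢ : ℕ → Digraph
  Gᵢ = E (suc j) sub zero

  zᵢ : (i : ℕ) → Fin (n (Gᵢ i))
  zᵢ = tip (E (suc j)) zero

  σ≥-Gᵢ : ∀ i t → σ≥ (Gᵢ i) (zᵢ i) t ≡ j ! * ((n (Gᵢ i) ∸ t) C suc i)
  σ≥-Gᵢ zero t = begin
    σ≥ (E (suc j)) zero t
      ≡⟨ σ≥-edgeless j t ⟩
    ∑[ c < suc j ] (if t ≤ᵇ toℕ c then j ! else 0)
      ≡⟨ sum-cong-≗ {suc j} (λ c → cong (λ x → if t ≤ᵇ toℕ c then x else 0) (ℕ.*-identityʳ (j !))) ⟨
    ∑[ c < suc j ] (if t ≤ᵇ toℕ c then j ! * ((suc j ∸ suc (toℕ c)) C 0) else 0)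
      ≡⟨ ∑-hockeyStick (suc j) t 0 (j !) ⟩
    j ! * ((suc j ∸ t) C 1) ∎
    where open ≡-Reasoning
  σ≥-Gᵢ (suc i) t = begin
    σ≥ (addPendant (Gᵢ i) (zᵢ i)) (fromℕ N) t
      ≡⟨ σ≥-addPendant (Gᵢ i) (zᵢ i) t ⟩
    ∑[ e < suc N ] (if t ≤ᵇ toℕ e then σ≥ (Gᵢ i) (zᵢ i) (toℕ e) else 0)
      ≡⟨ sum-cong-≗ {suc N} (λ e → cong (λ x → if t ≤ᵇ toℕ e then x else 0) (σ≥-Gᵢ i (toℕ e))) ⟩
    ∑[ e < suc N ] (if t ≤ᵇ toℕ e then j ! * ((N ∸ toℕ e) C suc i) else 0)
      ≡⟨ ∑-hockeyStick (suc N) t (suc i) (j !) ⟩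
    j ! * ((suc N ∸ t) C suc (suc i)) ∎
    where
    open ≡-Reasoning
    N = n (Gᵢ i)

  σ-Gᵢ : ∀ i → σ (Gᵢ i) ≡ j ! * ((suc j + i) C suc i)
  σ-Gᵢ i = begin
    σ (Gᵢ i)                     ≡⟨ count-≐ (isDisposition? (Gᵢ i)) (isDisposition≥? (Gᵢ i) (zᵢ i) 0)
                                            ((_, z≤n) , proj₁) ⟩
    σ≥ (Gᵢ i) (zᵢ i) 0           ≡⟨ σ≥-Gᵢ i 0 ⟩
    j ! * (n (Gᵢ i) C suc i)     ≡⟨ cong (λ x → j ! * (x C suc i)) (n-sub (E (suc j)) zero i) ⟩
    j ! * ((suc j + i) C suc i)  ∎
    where open ≡-Reasoning

  σ-Gᵢ≡∑ : ∀ i → σ (Gᵢ i) ≡ ∑[ k < suc i ] ((i C toℕ k) * (toℕ k ! * coefficient j (toℕ k)))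
  σ-Gᵢ≡∑ i = begin
    σ (Gᵢ i)
      ≡⟨ σ-Gᵢ i ⟩
    j ! * ((suc j + i) C suc i)
      ≡⟨ cong (j ! *_) (∑-vandermonde {suc i} i (suc j) 1 ℕ.≤-refl) ⟨
    j ! * ∑[ k < suc i ] ((i C toℕ k) * (suc j C suc (toℕ k)))
      ≡⟨ *-distribˡ-sum {suc i} (j !) (λ k → (i C toℕ k) * (suc j C suc (toℕ k))) ⟩
    ∑[ k < suc i ] (j ! * ((i C toℕ k) * (suc j C suc (toℕ k))))
      ≡⟨ sum-cong-≗ {suc i} (λ k → trans (x*[y*z]≡y*[x*z] (j !) (i C toℕ k) _)
           (cong ((i C toℕ k) *_) (sym (k!*coefficient≡j!*[1+j]C[1+k] j (toℕ k))))) ⟩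
    ∑[ k < suc i ] ((i C toℕ k) * (toℕ k ! * coefficient j (toℕ k))) ∎
    where open ≡-Reasoning

-- Companion coefficients

toℚᵘ-/ : ∀ a d → toℚᵘ (ℤ.+ a ℚ./ suc d) ≃ᵘ mkℚᵘ (ℤ.+ a) d
toℚᵘ-/ a d = ℚ.toℚᵘ-fromℚᵘ (mkℚᵘ (ℤ.+ a) d)

toℚ-+ : ∀ a b → toℚ (a + b) ≡ toℚ a ℚ.+ toℚ b
toℚ-+ a b = ℚ.toℚᵘ-injective (begin
  toℚᵘ (toℚ (a + b))                  ≈⟨ toℚᵘ-/ (a + b) 0 ⟩
  mkℚᵘ (ℤ.+ (a + b)) 0                ≈⟨ *≡* (cong (ℤ._* ℤ.+ 1) ℤ[a+b]≡a*1+b*1) ⟩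
  mkℚᵘ (ℤ.+ a) 0 ℚᵘ.+ mkℚᵘ (ℤ.+ b) 0  ≈⟨ ℚᵘ.+-cong (toℚᵘ-/ a 0) (toℚᵘ-/ b 0) ⟨
  toℚᵘ (toℚ a) ℚᵘ.+ toℚᵘ (toℚ b)      ≈⟨ ℚ.toℚᵘ-homo-+ (toℚ a) (toℚ b) ⟨
  toℚᵘ (toℚ a ℚ.+ toℚ b)              ∎)
  where
  open ℚᵘ.≃-Reasoning
  ℤ[a+b]≡a*1+b*1 : ℤ.+ (a + b) ≡ ℤ.+ a ℤ.* ℤ.+ 1 ℤ.+ ℤ.+ b ℤ.* ℤ.+ 1
  ℤ[a+b]≡a*1+b*1 = trans (ℤ.pos-+ a b) (sym (cong₂ ℤ._+_ (ℤ.*-identityʳ (ℤ.+ a)) (ℤ.*-identityʳ (ℤ.+ b))))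

toℚ-* : ∀ a b → toℚ (a * b) ≡ toℚ a ℚ.* toℚ b
toℚ-* a b = ℚ.toℚᵘ-injective (begin
  toℚᵘ (toℚ (a * b))                  ≈⟨ toℚᵘ-/ (a * b) 0 ⟩
  mkℚᵘ (ℤ.+ (a * b)) 0                ≈⟨ *≡* (cong (ℤ._* ℤ.+ 1) (ℤ.pos-* a b)) ⟩
  mkℚᵘ (ℤ.+ a) 0 ℚᵘ.* mkℚᵘ (ℤ.+ b) 0  ≈⟨ ℚᵘ.*-cong (toℚᵘ-/ a 0) (toℚᵘ-/ b 0) ⟨
  toℚᵘ (toℚ a) ℚᵘ.* toℚᵘ (toℚ b)      ≈⟨ ℚ.toℚᵘ-homo-* (toℚ a) (toℚ b) ⟨
  toℚᵘ (toℚ a ℚ.* toℚ b)              ∎)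
  where open ℚᵘ.≃-Reasoning

toℚ-*-1/ : ∀ c d e .{{_ : ℕ.NonZero d}} .{{_ : ℕ.NonZero e}} →
  c * d ≡ e → toℚ c ℚ.* (ℤ.+ 1 ℚ./ e) ≡ ℤ.+ 1 ℚ./ d
toℚ-*-1/ c (suc d) (suc e) c*d≡e = ℚ.toℚᵘ-injective in-ℚᵘ
  where
  cross-multiplied : (ℤ.+ c ℤ.* ℤ.+ 1) ℤ.* ℤ.+ suc d ≡ ℤ.+ 1 ℤ.* ℤ.+ (1 * suc e)
  cross-multiplied = begin
    (ℤ.+ c ℤ.* ℤ.+ 1) ℤ.* ℤ.+ suc d  ≡⟨ cong (ℤ._* ℤ.+ suc d) (ℤ.*-identityʳ (ℤ.+ c)) ⟩
    ℤ.+ c ℤ.* ℤ.+ suc d              ≡⟨ ℤ.pos-* c (suc d) ⟨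
    ℤ.+ (c * suc d)                  ≡⟨ cong ℤ.+_ (trans c*d≡e (sym (ℕ.*-identityˡ (suc e)))) ⟩
    ℤ.+ (1 * suc e)                  ≡⟨ ℤ.*-identityˡ (ℤ.+ (1 * suc e)) ⟨
    ℤ.+ 1 ℤ.* ℤ.+ (1 * suc e)        ∎
    where open ≡-Reasoning

  in-ℚᵘ : toℚᵘ (toℚ c ℚ.* (ℤ.+ 1 ℚ./ suc e)) ≃ᵘ toℚᵘ (ℤ.+ 1 ℚ./ suc d)
  in-ℚᵘ = begin
    toℚᵘ (toℚ c ℚ.* (ℤ.+ 1 ℚ./ suc e))        ≈⟨ ℚ.toℚᵘ-homo-* (toℚ c) _ ⟩
    toℚᵘ (toℚ c) ℚᵘ.* toℚᵘ (ℤ.+ 1 ℚ./ suc e)  ≈⟨ ℚᵘ.*-cong (toℚᵘ-/ c 0) (toℚᵘ-/ 1 e) ⟩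
    mkℚᵘ (ℤ.+ c) 0 ℚᵘ.* mkℚᵘ (ℤ.+ 1) e        ≈⟨ *≡* cross-multiplied ⟩
    mkℚᵘ (ℤ.+ 1) d                            ≈⟨ toℚᵘ-/ 1 d ⟨
    toℚᵘ (ℤ.+ 1 ℚ./ suc d)                    ∎
    where open ℚᵘ.≃-Reasoning

toℚ-*-inv! : ∀ c l m → c * m ! ≡ l ! → toℚ c ℚ.* inv! l ≡ inv! m
toℚ-*-inv! c l m = toℚ-*-1/ c (m !) (l !) {{m ℕ.!≢0}} {{l ℕ.!≢0}}

Σ≤-cong : ∀ i {f g : ℕ → ℚ} → (∀ k → k ≤ i → f k ≡ g k) → Σ≤ i f ≡ Σ≤ i g
Σ≤-cong zero    f≡g = f≡g 0 z≤n
Σ≤-cong (suc i) f≡g =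
  cong₂ ℚ._+_ (Σ≤-cong i λ k k≤i → f≡g k (ℕ.m≤n⇒m≤1+n k≤i)) (f≡g (suc i) ℕ.≤-refl)

Σ≤-*-distribʳ : ∀ i (f : ℕ → ℚ) c → Σ≤ i f ℚ.* c ≡ Σ≤ i (λ k → f k ℚ.* c)
Σ≤-*-distribʳ zero    f c = refl
Σ≤-*-distribʳ (suc i) f c =
  trans (ℚ.*-distribʳ-+ c (Σ≤ i f) (f (suc i))) (cong (ℚ._+ f (suc i) ℚ.* c) (Σ≤-*-distribʳ i f c))

toℚ-∑ : ∀ i (g : ℕ → ℕ) → toℚ (∑[ k < suc i ] g (toℕ k)) ≡ Σ≤ i (toℚ ∘ g)
toℚ-∑ zero    g = cong toℚ (ℕ.+-identityʳ (g 0))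
toℚ-∑ (suc i) g = begin
  toℚ (∑[ k < suc (suc i) ] g (toℕ k))
    ≡⟨ cong toℚ (sum-init-last {suc i} (g ∘ toℕ)) ⟩
  toℚ (∑[ k < suc i ] g (toℕ (inject₁ k)) + g (toℕ (fromℕ (suc i))))
    ≡⟨ cong toℚ (cong₂ _+_ (sum-cong-≗ {suc i} (cong g ∘ Fin.toℕ-inject₁))
                           (cong g (Fin.toℕ-fromℕ (suc i)))) ⟩
  toℚ (∑[ k < suc i ] g (toℕ k) + g (suc i))
    ≡⟨ toℚ-+ (∑[ k < suc i ] g (toℕ k)) (g (suc i)) ⟩
  toℚ (∑[ k < suc i ] g (toℕ k)) ℚ.+ toℚ (g (suc i))
    ≡⟨ cong (ℚ._+ toℚ (g (suc i))) (toℚ-∑ i g) ⟩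
  Σ≤ i (toℚ ∘ g) ℚ.+ toℚ (g (suc i)) ∎
  where open ≡-Reasoning

binomialTransform⇒isCompanion : (G : Digraph) (v : Fin (n G)) (b : ℕ → ℕ) →
  (∀ i → σ ((G sub v) i) ≡ ∑[ k < suc i ] ((i C toℕ k) * (toℕ k ! * b (toℕ k)))) →
  IsCompanion G v (toℚ ∘ b)
binomialTransform⇒isCompanion G v b σ≡ i = begin
  toℚ (σ ((G sub v) i)) ℚ.* inv! i            ≡⟨ cong (λ x → toℚ x ℚ.* inv! i) (σ≡ i) ⟩
  toℚ (∑[ k < suc i ] h (toℕ k)) ℚ.* inv! i   ≡⟨ cong (ℚ._* inv! i) (toℚ-∑ i h) ⟩
  Σ≤ i (toℚ ∘ h) ℚ.* inv! i                   ≡⟨ Σ≤-*-distribʳ i (toℚ ∘ h) (inv! i) ⟩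
  Σ≤ i (λ k → toℚ (h k) ℚ.* inv! i)           ≡⟨ Σ≤-cong i term ⟩
  Σ≤ i (λ k → toℚ (b k) ℚ.* inv! (i ∸ k))     ∎
  where
  open ≡-Reasoning
  h : ℕ → ℕ
  h k = (i C k) * (k ! * b k)

  term : ∀ k → k ≤ i → toℚ (h k) ℚ.* inv! i ≡ toℚ (b k) ℚ.* inv! (i ∸ k)
  term k k≤i = begin
    toℚ ((i C k) * (k ! * b k)) ℚ.* inv! i
      ≡⟨ cong (λ x → toℚ x ℚ.* inv! i)
              (trans (sym (ℕ.*-assoc (i C k) (k !) (b k))) (ℕ.*-comm ((i C k) * k !) (b k))) ⟩
    toℚ (b k * ((i C k) * k !)) ℚ.* inv! i
      ≡⟨ cong (ℚ._* inv! i) (toℚ-* (b k) ((i C k) * k !)) ⟩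
    toℚ (b k) ℚ.* toℚ ((i C k) * k !) ℚ.* inv! i
      ≡⟨ ℚ.*-assoc (toℚ (b k)) (toℚ ((i C k) * k !)) (inv! i) ⟩
    toℚ (b k) ℚ.* (toℚ ((i C k) * k !) ℚ.* inv! i)
      ≡⟨ cong (toℚ (b k) ℚ.*_) (toℚ-*-inv! ((i C k) * k !) i (i ∸ k)
           (trans (ℕ.*-assoc (i C k) (k !) ((i ∸ k) !)) (nCk*[k!*[n∸k]!]≡n! k≤i))) ⟩
    toℚ (b k) ℚ.* inv! (i ∸ k) ∎

Σ≤-inv!-injective : (a b : ℕ → ℚ) →
  (∀ i → Σ≤ i (λ k → a k ℚ.* inv! (i ∸ k)) ≡ Σ≤ i (λ k → b k ℚ.* inv! (i ∸ k))) →
  ∀ i k → k ≤ i → a k ≡ b k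
Σ≤-inv!-injective a b a≡b zero .zero z≤n =
  trans (sym (ℚ.*-identityʳ (a 0))) (trans (a≡b 0) (ℚ.*-identityʳ (b 0)))
Σ≤-inv!-injective a b a≡b (suc i) k k≤1+i with ℕ.m≤n⇒m<n∨m≡n k≤1+i
... | inj₁ (s≤s k≤i) = Σ≤-inv!-injective a b a≡b i k k≤i
... | inj₂ refl      = begin
  a (suc i)                    ≡⟨ ℚ.*-identityʳ (a (suc i)) ⟨
  a (suc i) ℚ.* inv! 0         ≡⟨ cong (λ x → a (suc i) ℚ.* inv! x) (ℕ.n∸n≡0 i) ⟨
  a (suc i) ℚ.* inv! (i ∸ i)   ≡⟨ +-cancelˡ (Σ≤ i (λ k → a k ℚ.* inv! (suc i ∸ k))) _ _
                                   (trans (a≡b (suc i)) (cong (ℚ._+ _) (sym lower))) ⟩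
  b (suc i) ℚ.* inv! (i ∸ i)   ≡⟨ cong (λ x → b (suc i) ℚ.* inv! x) (ℕ.n∸n≡0 i) ⟩
  b (suc i) ℚ.* inv! 0         ≡⟨ ℚ.*-identityʳ (b (suc i)) ⟩
  b (suc i)                    ∎
  where
  open ≡-Reasoning
  lower : Σ≤ i (λ k → a k ℚ.* inv! (suc i ∸ k)) ≡ Σ≤ i (λ k → b k ℚ.* inv! (suc i ∸ k))
  lower = Σ≤-cong i λ k k≤i → cong (ℚ._* inv! (suc i ∸ k)) (Σ≤-inv!-injective a b a≡b i k k≤i)

isCompanion-unique : ∀ {G v a b} → IsCompanion G v a → IsCompanion G v b → ∀ k → a k ≡ b k
isCompanion-unique {a = a} {b} a-companion b-companion k =
  Σ≤-inv!-injective a b (λ i → trans (sym (a-companion i)) (b-companion i)) k k ℕ.≤-refl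

isCompanion-edgeless : ∀ j → IsCompanion (E (suc j)) zero (toℚ ∘ coefficient j)
isCompanion-edgeless j =
  binomialTransform⇒isCompanion (E (suc j)) zero (coefficient j) (σ-Gᵢ≡∑ j)

mainTheorem10 : (j : ℕ) (a : ℕ → ℚ) → IsCompanion (E (suc j)) zero a →
    (k : ℕ) → k ≤ j → a k ≡ toℚ ((j C k) * (suc j C suc k) * (j ∸ k) !)
mainTheorem10 j a a-companion k _ =
  isCompanion-unique {a = a} {toℚ ∘ coefficient j} a-companion (isCompanion-edgeless j) k
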